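{- Let $G$ be a graph and let $H$ be a graph obtained from $G$ by applying at most $k$ labeled contractions. Then $\delta(H)\le \delta(G)+k$.
   Context: Graphs are finite, simple and undirected. For an edge $uv$ of $G$, the labeled contraction $(u,v)$ yields $G/(u,v)$: add an edge between $u$ and every vertex of $N_G(v)\setminus N_G[u]$, then delete $v$; contractions are applied one after another, each to an edge of the current graph. $\delta(G)$ denotes the degeneracy of $G$: the minimum, over all total orders $\sigma$ of $V(G)$, of the maximum over $u\in V(G)$ of the number of neighbors of $u$ that come after $u$ in $\sigma$ (equivalently, the smallest integer $d$ such that every subgraph of $G$ has a vertex of degree at most $d$). -}

module Defs where

open import Data.Nat using (ℕ; zero; suc; _+_; _≤_)
open import Data.Fin using (Fin; _≟_; punchIn; _<?_)
open import Data.Fin.Permutation using (Permutation′; _⟨$⟩ʳ_)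
open import Data.Bool using (Bool; true; false; T; _∧_; _∨_; if_then_else_)
open import Data.Bool.Properties using (∨-comm)
import Data.Bool.Properties
open import Data.List using (List; length; filter)
open import Data.List.Base using (allFin)
open import Data.Product using (Σ; ∃; _×_; _,_)
open import Relation.Nullary using (¬_; Dec; yes; no)
open import Relation.Nullary.Decidable using (⌊_⌋)
open import Relation.Binary.PropositionalEquality using (_≡_; refl; cong) renaming (sym to ≡-sym)

record Graph (n : ℕ) : Set where
  field
    adj   : Fin n → Fin n → Bool
    symm  : ∀ x y → adj x y ≡ adj y x
    irrefl : ∀ x → adj x x ≡ false
open Graph public

_==_ : ∀ {n} → Fin n → Fin n → Bool
x == y = ⌊ x ≟ y ⌋

==-sym : ∀ {n} (x y : Fin n) → (x == y) ≡ (y == x)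
==-sym x y with x ≟ y | y ≟ x
... | yes _ | yes _ = refl
... | no _  | no _  = refl
... | yes p | no q  with q (≡-sym p)
... | ()
==-sym x y | no p | yes q with p (≡-sym q)
... | ()

==-refl : ∀ {n} (x : Fin n) → (x == x) ≡ true
==-refl x with x ≟ x
... | yes _ = refl
... | no p with p refl
... | ()

-- Labeled contraction (u,v) of the edge uv in a graph on Fin (suc m):
-- the vertex v is deleted (remaining vertices are Fin m, embedded into
-- Fin (suc m) via punchIn v), and u becomes adjacent to every neighbour of v
-- (other than u itself).  Adding the edges to N(v) \ N[u] is the same as
-- taking the union of N(u) and N(v) minus u, which is what is written here.
contractAdj : ∀ {m} → Graph (suc m) → Fin (suc m) → Fin (suc m) →
              Fin m → Fin m → Bool
contractAdj G u v x y =
  if x == y then false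
  else (adj G a b ∨ ((a == u) ∧ adj G v b) ∨ ((b == u) ∧ adj G v a))
  where
    a = punchIn v x
    b = punchIn v y

private
  ∨-swap : ∀ p q r → (p ∨ q ∨ r) ≡ (p ∨ r ∨ q)
  ∨-swap false q r = ∨-comm q r
  ∨-swap true  q r = refl

contractAdj-sym : ∀ {m} (G : Graph (suc m)) u v (x y : Fin m) →
                  contractAdj G u v x y ≡ contractAdj G u v y x
contractAdj-sym G u v x y rewrite ==-sym x y with y == x
... | true  = refl
... | false rewrite Graph.symm G (punchIn v x) (punchIn v y) =
  ∨-swap (adj G (punchIn v y) (punchIn v x))
         ((punchIn v x == u) ∧ adj G v (punchIn v y))
         ((punchIn v y == u) ∧ adj G v (punchIn v x))

contractAdj-irrefl : ∀ {m} (G : Graph (suc m)) u v (x : Fin m) →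
                     contractAdj G u v x x ≡ false
contractAdj-irrefl G u v x rewrite ==-refl x = refl

contract : ∀ {m} → Graph (suc m) → Fin (suc m) → Fin (suc m) → Graph m
contract G u v = record
  { adj    = contractAdj G u v
  ; symm   = contractAdj-sym G u v
  ; irrefl = contractAdj-irrefl G u v
  }

data Contractions : ∀ {n m} → Graph n → Graph m → ℕ → Set where
  done : ∀ {n} (G : Graph n) → Contractions G G 0
  step : ∀ {m p j} (G : Graph (suc m)) (H : Graph p) (u v : Fin (suc m)) →
         T (adj G u v) →
         Contractions (contract G u v) H j →
         Contractions G H (suc j)

-- Number of neighbours of u that come after u in the total order σ
-- (σ maps a vertex to its position).
forwardDegree : ∀ {n} → Graph n → Permutation′ n → Fin n → ℕ
forwardDegree G σ u =
  length (filter (λ w → _<?_ (σ ⟨$⟩ʳ u) (σ ⟨$⟩ʳ w))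
                 (filter (λ w → Data.Bool.Properties._≟_ (adj G u w) true) (allFin _)))

-- δ(G) ≤ d : some total order of V(G) in which every vertex has at most d
-- later neighbours.  (δ(G) is the least such d.)
DegeneracyAtMost : ∀ {n} → Graph n → ℕ → Set
DegeneracyAtMost {n} G d =
  Σ (Permutation′ n) λ σ → ∀ u → forwardDegree G σ u ≤ d

module Submission where

-- Let σ order G with at most d later neighbours per vertex, and contract the edge uv.  Order
-- G/(u,v) like σ, but with u moved to the very end.  Then u has no later neighbour, and any
-- other vertex x is adjacent in G/(u,v) to a vertex y ≠ u only if x and y are adjacent in G;
-- so x keeps its old later neighbours (minus v) and possibly gains u: at most d + 1 in all.

open import Data.Bool using (Bool; true; false; T; _∧_; if_then_else_)
import Data.Bool.Properties as Bool
open import Data.Empty using (⊥-elim)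
open import Data.Fin using (Fin; zero; suc; punchIn; punchOut; fromℕ; _<_; _<?_; _≟_)
  renaming (_≤_ to _≤ᶠ_)
open import Data.Fin.Permutation
  using (Permutation; Permutation′; _⟨$⟩ʳ_; remove; insert; insert-punchIn)
  renaming (id to idₚ)
open import Data.Fin.Properties
  using (punchIn-mono-≤; punchOut-mono-≤; punchIn-injective; punchInᵢ≢i; punchIn-punchOut; ≤fromℕ)
open import Data.List using (filter; length; tabulate)
open import Data.Nat using (ℕ; zero; suc; _+_; _≤_; z≤n; s≤s)
import Data.Nat.Properties as ℕ
open import Data.Product using (_×_; _,_; proj₁; proj₂)
open import Function using (_∘_)
open import Function.Bundles using (Equivalence)
open import Level using (0ℓ)
open import Relation.Binary.PropositionalEquality using (_≡_; _≢_; refl; cong; sym; trans; subst)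
open import Relation.Nullary using (Dec; does; yes; no; ¬_)
open import Relation.Nullary.Decidable using (toWitness; fromWitness; isYes≗does)
open import Relation.Unary using (Pred; Decidable)

open import Algebra.Properties.CommutativeMonoid.Sum ℕ.+-0-commutativeMonoid using (sum; sum-remove)
open import Defs

count : ∀ {n} → (Fin n → Bool) → ℕ
count f = sum (λ i → if f i then 1 else 0)

count-mono : ∀ {n} {f g : Fin n → Bool} → (∀ i → T (f i) → T (g i)) → count f ≤ count g
count-mono {zero}          f⇒g = z≤n
count-mono {suc n} {f} {g} f⇒g with f zero | g zero | f⇒g zero
... | false | false | _ = count-mono (f⇒g ∘ suc)
... | false | true  | _ = ℕ.m≤n⇒m≤1+n (count-mono (f⇒g ∘ suc))
... | true  | true  | _ = s≤s (count-mono (f⇒g ∘ suc))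
... | true  | false | f₀⇒g₀ = ⊥-elim (f₀⇒g₀ _)

count-none : ∀ {n} {f : Fin n → Bool} → (∀ i → ¬ T (f i)) → count f ≡ 0
count-none {zero}      ¬f = refl
count-none {suc n} {f} ¬f with f zero | ¬f zero
... | false | _   = count-none (¬f ∘ suc)
... | true  | ¬f₀ = ⊥-elim (¬f₀ _)

count-punchIn-≤ : ∀ {n} (f : Fin (suc n) → Bool) i → count (f ∘ punchIn i) ≤ count f
count-punchIn-≤ f i rewrite sum-remove {i = i} (λ j → if f j then 1 else 0) = ℕ.m≤n+m _ _

count-≤-suc-punchIn : ∀ {n} (f : Fin (suc n) → Bool) i → count f ≤ suc (count (f ∘ punchIn i))
count-≤-suc-punchIn f i rewrite sum-remove {i = i} (λ j → if f j then 1 else 0) with f i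
... | true  = ℕ.≤-refl
... | false = ℕ.n≤1+n _

length-filter-filter-tabulate : ∀ {A : Set} {P Q : Pred A 0ℓ} (P? : Decidable P) (Q? : Decidable Q)
  {n} (g : Fin n → A) →
  length (filter P? (filter Q? (tabulate g))) ≡ count (λ i → does (Q? (g i)) ∧ does (P? (g i)))
length-filter-filter-tabulate P? Q? {zero}  g = refl
length-filter-filter-tabulate P? Q? {suc n} g with does (Q? (g zero))
... | false = length-filter-filter-tabulate P? Q? (g ∘ suc)
... | true with does (P? (g zero))
...   | false = length-filter-filter-tabulate P? Q? (g ∘ suc)
...   | true  = cong suc (length-filter-filter-tabulate P? Q? (g ∘ suc))

T-does⁻ : ∀ {A : Set} (a? : Dec A) → T (does a?) → A
T-does⁻ a? h = toWitness (subst T (sym (isYes≗does a?)) h)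

T-does⁺ : ∀ {A : Set} (a? : Dec A) → A → T (does a?)
T-does⁺ a? a = subst T (isYes≗does a?) (fromWitness a)

laterNeighbour : ∀ {n} → Graph n → Permutation′ n → Fin n → Fin n → Bool
laterNeighbour G σ u w = does (adj G u w Bool.≟ true) ∧ does (σ ⟨$⟩ʳ u <? σ ⟨$⟩ʳ w)

forwardDegree-count : ∀ {n} (G : Graph n) σ u → forwardDegree G σ u ≡ count (laterNeighbour G σ u)
forwardDegree-count G σ u =
  length-filter-filter-tabulate (λ w → σ ⟨$⟩ʳ u <? σ ⟨$⟩ʳ w) (λ w → adj G u w Bool.≟ true) (λ w → w)

laterNeighbour⁻ : ∀ {n} (G : Graph n) σ u w → T (laterNeighbour G σ u w) →
                  T (adj G u w) × σ ⟨$⟩ʳ u < σ ⟨$⟩ʳ w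
laterNeighbour⁻ G σ u w h with Equivalence.to (Bool.T-∧ {does (adj G u w Bool.≟ true)}) h
... | isAdj , isLater = Equivalence.from Bool.T-≡ (T-does⁻ (adj G u w Bool.≟ true) isAdj)
                      , T-does⁻ (σ ⟨$⟩ʳ u <? σ ⟨$⟩ʳ w) isLater

laterNeighbour⁺ : ∀ {n} (G : Graph n) σ u w → T (adj G u w) → σ ⟨$⟩ʳ u < σ ⟨$⟩ʳ w →
                  T (laterNeighbour G σ u w)
laterNeighbour⁺ G σ u w isAdj isLater =
  Equivalence.from (Bool.T-∧ {does (adj G u w Bool.≟ true)})
    ( T-does⁺ (adj G u w Bool.≟ true) (Equivalence.to Bool.T-≡ isAdj)
    , T-does⁺ (σ ⟨$⟩ʳ u <? σ ⟨$⟩ʳ w) isLater )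

punchIn-elim : ∀ {n} (P : Fin (suc n) → Set) i → P i → (∀ k → P (punchIn i k)) → ∀ x → P x
punchIn-elim P i Pi P-punchIn x with i ≟ x
... | yes refl = Pi
... | no i≢x   = subst P (punchIn-punchOut i≢x) (P-punchIn (punchOut i≢x))

punchIn-cancel-< : ∀ {n} (i : Fin (suc n)) {j k : Fin n} → punchIn i j < punchIn i k → j < k
punchIn-cancel-< i {j} {k} lt = ℕ.≰⇒> λ k≤j → ℕ.<⇒≱ lt (punchIn-mono-≤ i k j k≤j)

remove-cancel-< : ∀ {m n} i (σ : Permutation (suc m) (suc n)) {j k} →
                  remove i σ ⟨$⟩ʳ j < remove i σ ⟨$⟩ʳ k →
                  σ ⟨$⟩ʳ punchIn i j < σ ⟨$⟩ʳ punchIn i k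
remove-cancel-< i σ lt = ℕ.≰⇒> λ k≤j → ℕ.<⇒≱ lt (punchOut-mono-≤ {i = σ ⟨$⟩ʳ i} _ _ k≤j)

insert-cancel-< : ∀ {m n} i j (π : Permutation m n) {k l} →
                  insert i j π ⟨$⟩ʳ punchIn i k < insert i j π ⟨$⟩ʳ punchIn i l →
                  π ⟨$⟩ʳ k < π ⟨$⟩ʳ l
insert-cancel-< i j π {k} {l} lt rewrite insert-punchIn i j π k | insert-punchIn i j π l =
  punchIn-cancel-< j lt

insert-self : ∀ {m n} i j (π : Permutation m n) → insert i j π ⟨$⟩ʳ i ≡ j
insert-self i j π with i ≟ i
... | yes _  = refl
... | no i≢i = ⊥-elim (i≢i refl)

contract-adj⁻ : ∀ {m} (G : Graph (suc m)) u v {x y : Fin m} →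
                punchIn v x ≢ u → punchIn v y ≢ u →
                T (adj (contract G u v) x y) → T (adj G (punchIn v x) (punchIn v y))
contract-adj⁻ G u v {x} {y} x≢u y≢u h with x ≟ y | punchIn v x ≟ u | punchIn v y ≟ u
... | yes _ | _       | _       = ⊥-elim h
... | no _  | yes x≡u | _       = ⊥-elim (x≢u x≡u)
... | no _  | no _    | yes y≡u = ⊥-elim (y≢u y≡u)
... | no _  | no _    | no _    = subst T (Bool.∨-identityʳ _) h

degeneracy-contract : ∀ {m} (G : Graph (suc m)) u v → T (adj G u v) → ∀ {d} →
                      DegeneracyAtMost G d → DegeneracyAtMost (contract G u v) (suc d)
degeneracy-contract {zero}  G u v uv     _                 = idₚ , λ ()
degeneracy-contract {suc m} G u v uv {d} (σ , σ-bounded) = ρ , ρ-bounded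
  where
  H = contract G u v

  v≢u : v ≢ u
  v≢u refl = subst T (irrefl G v) uv

  -- u′ is the name of u in H, whose vertices are those of G other than v, renumbered.
  u′ : Fin (suc m)
  u′ = punchOut v≢u

  ρ : Permutation′ (suc m)
  ρ = insert u′ (fromℕ m) (remove u′ (remove v σ))

  embed : Fin m → Fin (suc (suc m))
  embed = punchIn v ∘ punchIn u′

  embed≢u : ∀ k → embed k ≢ u
  embed≢u k eq = punchInᵢ≢i u′ k (punchIn-injective v _ _ (trans eq (sym (punchIn-punchOut v≢u))))

  u′-last : ∀ w → ¬ T (laterNeighbour H ρ u′ w)
  u′-last w h = ℕ.<⇒≱ (proj₂ (laterNeighbour⁻ H ρ u′ w h))
                      (subst (ρ ⟨$⟩ʳ w ≤ᶠ_) (sym (insert-self u′ (fromℕ m) _)) (≤fromℕ _))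

  later-embed : ∀ k l → T (laterNeighbour H ρ (punchIn u′ k) (punchIn u′ l)) →
                T (laterNeighbour G σ (embed k) (embed l))
  later-embed k l h = laterNeighbour⁺ G σ (embed k) (embed l)
    (contract-adj⁻ G u v (embed≢u k) (embed≢u l) isAdj)
    (remove-cancel-< v σ (remove-cancel-< u′ (remove v σ)
      (insert-cancel-< u′ (fromℕ m) (remove u′ (remove v σ)) {k} {l} isLater)))
    where
    isAdj   = proj₁ (laterNeighbour⁻ H ρ (punchIn u′ k) (punchIn u′ l) h)
    isLater = proj₂ (laterNeighbour⁻ H ρ (punchIn u′ k) (punchIn u′ l) h)

  punchIn-bounded : ∀ k → forwardDegree H ρ (punchIn u′ k) ≤ suc d
  punchIn-bounded k = begin
    forwardDegree H ρ x                             ≡⟨ forwardDegree-count H ρ x ⟩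
    count (laterNeighbour H ρ x)                    ≤⟨ count-≤-suc-punchIn (laterNeighbour H ρ x) u′ ⟩
    suc (count (laterNeighbour H ρ x ∘ punchIn u′)) ≤⟨ s≤s (count-mono (later-embed k)) ⟩
    suc (count (laterNeighbour G σ y ∘ embed))      ≤⟨ s≤s (count-punchIn-≤ (laterNeighbour G σ y ∘ punchIn v) u′) ⟩
    suc (count (laterNeighbour G σ y ∘ punchIn v))  ≤⟨ s≤s (count-punchIn-≤ (laterNeighbour G σ y) v) ⟩
    suc (count (laterNeighbour G σ y))              ≡⟨ cong suc (forwardDegree-count G σ y) ⟨
    suc (forwardDegree G σ y)                       ≤⟨ s≤s (σ-bounded y) ⟩
    suc d                                           ∎
    where
    open ℕ.≤-Reasoning
    x = punchIn u′ k
    y = embed k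

  ρ-bounded : ∀ x → forwardDegree H ρ x ≤ suc d
  ρ-bounded = punchIn-elim (λ x → forwardDegree H ρ x ≤ suc d) u′
    (subst (_≤ suc d) (sym (trans (forwardDegree-count H ρ u′) (count-none u′-last))) z≤n)
    punchIn-bounded

degeneracy-mono : ∀ {n} (G : Graph n) {d d′} → d ≤ d′ → DegeneracyAtMost G d → DegeneracyAtMost G d′
degeneracy-mono G d≤d′ (σ , σ-bounded) = σ , λ u → ℕ.≤-trans (σ-bounded u) d≤d′

degeneracy-contractions : ∀ {n m} {G : Graph n} {H : Graph m} {j} → Contractions G H j →
                          ∀ {d} → DegeneracyAtMost G d → DegeneracyAtMost H (d + j)
degeneracy-contractions (done G) {d} δG =
  subst (DegeneracyAtMost G) (sym (ℕ.+-identityʳ d)) δG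
degeneracy-contractions (step G H u v uv G/uv↝H) {d} δG =
  subst (DegeneracyAtMost H) (sym (ℕ.+-suc d _))
    (degeneracy-contractions G/uv↝H (degeneracy-contract G u v uv δG))

lemma6 : ∀ {n m} (G : Graph n) (H : Graph m) (k j : ℕ) →
         j ≤ k → Contractions G H j →
         ∀ d → DegeneracyAtMost G d → DegeneracyAtMost H (d + k)
lemma6 G H k j j≤k G↝H d δG =
  degeneracy-mono H (ℕ.+-monoʳ-≤ d j≤k) (degeneracy-contractions G↝H δG)
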